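{- Let $\lambda=(\lambda_1,\dots,\lambda_r)$ be a composition of $n$ and let $t\in\{1,\dots,r\}$ be such that $s_t=0$, where $s_t=\sum_{j>t}\lambda_j-\sum_{j<t}\lambda_j$. Then the number of orbits of $T_\lambda$ is $$\gamma(T_\lambda)=\lambda_t+\gamma\big(T_{(\lambda_1,\dots,\lambda_{t-1},\lambda_{t+1},\dots,\lambda_r)}\big).$$
   Context: A composition of $n$ is a finite sequence $(\lambda_1,\dots,\lambda_r)$ of positive integers with sum $n$. For $\llbracket a,b\rrbracket=[a,b]\cap\mathbb{Z}$, define $B_i=\llbracket 1+\sum_{j<i}\lambda_j,\ \sum_{j\le i}\lambda_j\rrbracket$ and $s_i=\sum_{j>i}\lambda_j-\sum_{j<i}\lambda_j$. The symmetric discrete interval exchange $T_\lambda$ is the permutation of $\llbracket 1,n\rrbracket$ given by $T_\lambda(x)=x+s_i$ for $x\in B_i$. $\gamma(\sigma)$ denotes the number of orbits (cycles, including fixed points) of a permutation $\sigma$. If $r=1$, the composition with the part removed is the empty sequence, for which $T$ is the empty permutation with $0$ orbits. -}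

module Defs where

open import Data.Nat using (ℕ; zero; suc; _+_; _∸_; _≤ᵇ_)
open import Data.Bool using (Bool; if_then_else_)
open import Data.List using (List; []; _∷_; length; filterᵇ; iterate; upTo; map)
open import Data.Nat.ListAction using (sum)
open import Data.Bool using (true; _∧_)

allᵇ : (ℕ → Bool) → List ℕ → Bool
allᵇ p []       = true
allᵇ p (y ∷ ys) = p y ∧ allᵇ p ys

-- A composition of n is a list of positive naturals with sum n
-- (positivity is imposed as a hypothesis in the statement).

-- Auxiliary for T: b = sum of the parts already passed (Σ_{j<i} λ_j).
-- On block B_i = [b+1, b+λ_i] we send x to x + s_i = x + Σ_{j>i} λ_j - b
-- (exact subtraction, since x > b on B_i).
T-go : ℕ → List ℕ → ℕ → ℕ
T-go b []       x = x
T-go b (p ∷ ps) x = if x ≤ᵇ b + p then x + sum ps ∸ b else T-go (b + p) ps x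

-- The symmetric discrete interval exchange T_λ, as a map on ℕ; it is
-- only meaningful on ⟦1, n⟧ with n = sum λ.
Tλ : List ℕ → ℕ → ℕ
Tλ λs = T-go 0 λs

-- x is the least element of its orbit under f (orbit length ≤ n on ⟦1,n⟧).
isCycleMin : ℕ → (ℕ → ℕ) → ℕ → Bool
isCycleMin n f x = allᵇ (λ y → x ≤ᵇ y) (iterate f x (suc n))

-- γ: number of orbits of a permutation f of ⟦1, n⟧, counted as the number
-- of orbits' minima (each orbit has exactly one minimum).
γ : ℕ → (ℕ → ℕ) → ℕ
γ n f = length (filterᵇ (isCycleMin n f) (map suc (upTo n)))

γT : List ℕ → ℕ
γT λs = γ (sum λs) (Tλ λs)

{-# OPTIONS --safe #-}
module Submission where

-- Write λ = L ++ λₜ ∷ R, so that s_t = 0 says Σ L = Σ R = a.  Then T_λ fixes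
-- the middle block ⟦a+1, a+λₜ⟧ pointwise, and off that block it is conjugate
-- to T_{L ++ R} by the strictly increasing map ι that opens a gap of width λₜ
-- above a.  A strictly increasing conjugacy matches orbit minima, and the
-- middle block contributes λₜ fixed points.  Since γ n only inspects the first
-- n + 1 iterates, one also needs that an orbit inside ⟦1, n⟧ has already shown
-- all its points by then (pigeonhole).

open import Defs
open import Data.Nat using (ℕ; zero; suc; _+_; _∸_; _≤_; _<_; _≤?_; _<?_; z≤n; s≤s; z<s; s<s; s≤s⁻¹; _≤ᵇ_)
open import Data.Nat.Properties
open import Data.Nat.ListAction using (sum)
open import Data.Nat.ListAction.Properties using (sum-++)
open import Algebra.Properties.CommutativeSemigroup +-commutativeSemigroup using (x∙yz≈y∙xz; xy∙z≈xz∙y; xy∙z≈x∙zy)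
open import Data.Bool using (Bool; true; false; T; if_then_else_)
open import Data.Bool.Properties using (T-∧)
open import Data.Empty using (⊥-elim)
open import Data.Fin using (Fin; toℕ; fromℕ<; zero; suc)
open import Data.Fin.Properties using (pigeonhole; toℕ<n; toℕ-fromℕ<)
open import Data.List using (List; []; _∷_; _++_; length; lookup; removeAt; take; drop; iterate; applyUpTo; filterᵇ)
open import Data.List.Properties using (length-++; filter-++; map-upTo)
open import Data.List.Relation.Unary.All using (All)
open import Data.Product using (_×_; _,_; ∃; proj₁; proj₂)
open import Data.Sum using (inj₁; inj₂)
open import Data.Unit using (tt)
open import Function using (_∘_; _⇔_; mk⇔; Equivalence)
open import Function.Properties.Equivalence using () renaming (trans to ⇔-trans; sym to ⇔-sym)
open import Level using (0ℓ)
open import Relation.Binary using (_Preserves_⟶_)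
open import Relation.Binary.PropositionalEquality
open import Relation.Nullary using (¬_; yes; no; contradiction)
open import Relation.Nullary.Decidable using (T?; dec-true; dec-false)
open import Relation.Unary using (Pred; _∈_)

open Equivalence using (to; from)

⟦_,_⟧ : ℕ → ℕ → Pred ℕ 0ℓ
⟦ a , b ⟧ x = a ≤ x × x ≤ b

⟦suc,+0⟧-empty : ∀ b {x} → ¬ x ∈ ⟦ suc b , b + 0 ⟧
⟦suc,+0⟧-empty b {x} (b<x , x≤b+0) = <⇒≱ b<x (subst (x ≤_) (+-identityʳ b) x≤b+0)

T-go-head : ∀ b p ps {x} → x ≤ b + p → T-go b (p ∷ ps) x ≡ x + sum ps ∸ b
T-go-head b p ps {x} x≤b+p rewrite dec-true (x ≤? b + p) x≤b+p = refl

T-go-tail : ∀ b p ps {x} → b + p < x → T-go b (p ∷ ps) x ≡ T-go (b + p) ps x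
T-go-tail b p ps {x} b+p<x rewrite dec-false (x ≤? b + p) (<⇒≱ b+p<x) = refl

T-go-range : ∀ b ps {x} → x ∈ ⟦ suc b , b + sum ps ⟧ → T-go b ps x ∈ ⟦ 1 , sum ps ⟧
T-go-range b []       x∈ = ⊥-elim (⟦suc,+0⟧-empty b x∈)
T-go-range b (p ∷ ps) {x} (b<x , x≤) with x ≤? b + p
... | yes x≤b+p = subst (_∈ ⟦ 1 , p + sum ps ⟧) (sym (T-go-head b p ps x≤b+p))
  (subst (_∈ ⟦ 1 , p + sum ps ⟧) (sym (+-∸-comm (sum ps) (<⇒≤ b<x)))
    (≤-trans (m<n⇒0<n∸m b<x) (m≤m+n _ _) , +-monoˡ-≤ (sum ps) (m≤n+o⇒m∸n≤o x b x≤b+p)))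
... | no x≰b+p = subst (_∈ ⟦ 1 , p + sum ps ⟧) (sym (T-go-tail b p ps (≰⇒> x≰b+p)))
  (let (1≤ , ≤sum) = T-go-range (b + p) ps (≰⇒> x≰b+p , subst (x ≤_) (sym (+-assoc b p (sum ps))) x≤)
   in 1≤ , ≤-trans ≤sum (m≤n+m (sum ps) p))

Tλ-into : ∀ λs {x} → x ∈ ⟦ 1 , sum λs ⟧ → Tλ λs x ∈ ⟦ 1 , sum λs ⟧
Tλ-into = T-go-range 0

T-go-++ˡ : ∀ b L M {x} → x ∈ ⟦ suc b , b + sum L ⟧ → T-go b (L ++ M) x ≡ T-go b L x + sum M
T-go-++ˡ b []      M x∈ = ⊥-elim (⟦suc,+0⟧-empty b x∈)
T-go-++ˡ b (p ∷ L) M {x} (b<x , x≤) with x ≤? b + p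
... | yes x≤b+p = begin
  T-go b (p ∷ L ++ M) x          ≡⟨ T-go-head b p (L ++ M) x≤b+p ⟩
  x + sum (L ++ M) ∸ b           ≡⟨ cong (λ s → x + s ∸ b) (sum-++ L M) ⟩
  x + (sum L + sum M) ∸ b        ≡⟨ cong (_∸ b) (+-assoc x (sum L) (sum M)) ⟨
  x + sum L + sum M ∸ b          ≡⟨ +-∸-comm (sum M) (≤-trans (<⇒≤ b<x) (m≤m+n x (sum L))) ⟩
  x + sum L ∸ b + sum M          ≡⟨ cong (_+ sum M) (T-go-head b p L x≤b+p) ⟨
  T-go b (p ∷ L) x + sum M       ∎
  where open ≡-Reasoning
... | no x≰b+p = begin
  T-go b (p ∷ L ++ M) x          ≡⟨ T-go-tail b p (L ++ M) (≰⇒> x≰b+p) ⟩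
  T-go (b + p) (L ++ M) x        ≡⟨ T-go-++ˡ (b + p) L M (≰⇒> x≰b+p , subst (x ≤_) (sym (+-assoc b p (sum L))) x≤) ⟩
  T-go (b + p) L x + sum M       ≡⟨ cong (_+ sum M) (T-go-tail b p L (≰⇒> x≰b+p)) ⟨
  T-go b (p ∷ L) x + sum M       ∎
  where open ≡-Reasoning

T-go-++ʳ : ∀ b L M {x} → b + sum L < x → T-go b (L ++ M) x ≡ T-go (b + sum L) M x
T-go-++ʳ b []      M {x} _ = cong (λ c → T-go c M x) (sym (+-identityʳ b))
T-go-++ʳ b (p ∷ L) M {x} b+[p+L]<x = begin
  T-go b (p ∷ L ++ M) x          ≡⟨ T-go-tail b p (L ++ M) (≤-<-trans (m≤m+n (b + p) (sum L)) b+p+L<x) ⟩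
  T-go (b + p) (L ++ M) x        ≡⟨ T-go-++ʳ (b + p) L M b+p+L<x ⟩
  T-go (b + p + sum L) M x       ≡⟨ cong (λ c → T-go c M x) (+-assoc b p (sum L)) ⟩
  T-go (b + (p + sum L)) M x     ∎
  where
  open ≡-Reasoning
  b+p+L<x : b + p + sum L < x
  b+p+L<x = subst (_< x) (sym (+-assoc b p (sum L))) b+[p+L]<x

T-go-shift : ∀ b q R {x} → x ∈ ⟦ suc b , b + sum R ⟧ → T-go (b + q) R (x + q) ≡ T-go b R x
T-go-shift b q []      x∈ = ⊥-elim (⟦suc,+0⟧-empty b x∈)
T-go-shift b q (p ∷ R) {x} (b<x , x≤) with x ≤? b + p
... | yes x≤b+p = begin
  T-go (b + q) (p ∷ R) (x + q)   ≡⟨ T-go-head (b + q) p R x+q≤b+q+p ⟩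
  x + q + sum R ∸ (b + q)        ≡⟨ +-∸-comm (sum R) (+-monoˡ-≤ q (<⇒≤ b<x)) ⟩
  x + q ∸ (b + q) + sum R        ≡⟨ cong (_+ sum R) x+q∸[b+q]≡x∸b ⟩
  x ∸ b + sum R                  ≡⟨ +-∸-comm (sum R) (<⇒≤ b<x) ⟨
  x + sum R ∸ b                  ≡⟨ T-go-head b p R x≤b+p ⟨
  T-go b (p ∷ R) x               ∎
  where
  open ≡-Reasoning
  x+q≤b+q+p : x + q ≤ b + q + p
  x+q≤b+q+p = subst (x + q ≤_) (xy∙z≈xz∙y b p q) (+-monoˡ-≤ q x≤b+p)
  x+q∸[b+q]≡x∸b : x + q ∸ (b + q) ≡ x ∸ b
  x+q∸[b+q]≡x∸b = trans (cong₂ _∸_ (+-comm x q) (+-comm b q)) ([m+n]∸[m+o]≡n∸o q x b)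
... | no x≰b+p = begin
  T-go (b + q) (p ∷ R) (x + q)   ≡⟨ T-go-tail (b + q) p R b+q+p<x+q ⟩
  T-go (b + q + p) R (x + q)     ≡⟨ cong (λ c → T-go c R (x + q)) (xy∙z≈xz∙y b q p) ⟩
  T-go (b + p + q) R (x + q)     ≡⟨ T-go-shift (b + p) q R (b+p<x , subst (x ≤_) (sym (+-assoc b p (sum R))) x≤) ⟩
  T-go (b + p) R x               ≡⟨ T-go-tail b p R b+p<x ⟨
  T-go b (p ∷ R) x               ∎
  where
  open ≡-Reasoning
  b+p<x : b + p < x
  b+p<x = ≰⇒> x≰b+p
  b+q+p<x+q : b + q + p < x + q
  b+q+p<x+q = subst (_< x + q) (xy∙z≈xz∙y b p q) (+-monoˡ-< q b+p<x)

infixr 8 _^_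
_^_ : (ℕ → ℕ) → ℕ → ℕ → ℕ
(f ^ zero)  x = x
(f ^ suc k) x = (f ^ k) (f x)

^-suc : ∀ f k x → (f ^ suc k) x ≡ f ((f ^ k) x)
^-suc f zero    x = refl
^-suc f (suc k) x = ^-suc f k (f x)

^-fixed : ∀ {f x} → f x ≡ x → ∀ k → (f ^ k) x ≡ x
^-fixed fx≡x zero    = refl
^-fixed fx≡x (suc k) = trans (cong (_ ^ k) fx≡x) (^-fixed fx≡x k)

^-mod-period : ∀ {f x i j} → i < j → (f ^ i) x ≡ (f ^ j) x →
               ∀ k → ∃ λ l → l < j × (f ^ k) x ≡ (f ^ l) x
^-mod-period i<j _ zero = 0 , ≤-<-trans z≤n i<j , refl
^-mod-period {f} {x} {i} {j} i<j fⁱx≡fʲx (suc k) with ^-mod-period i<j fⁱx≡fʲx k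
... | l , l<j , fᵏx≡fˡx with suc l <? j
...   | yes 1+l<j = suc l , 1+l<j , fᵏ⁺¹x≡fˡ⁺¹x
  where
  fᵏ⁺¹x≡fˡ⁺¹x : (f ^ suc k) x ≡ (f ^ suc l) x
  fᵏ⁺¹x≡fˡ⁺¹x = trans (^-suc f k x) (trans (cong f fᵏx≡fˡx) (sym (^-suc f l x)))
...   | no 1+l≮j = i , i<j , trans fᵏ⁺¹x≡fʲx (sym fⁱx≡fʲx)
  where
  fᵏ⁺¹x≡fʲx : (f ^ suc k) x ≡ (f ^ j) x
  fᵏ⁺¹x≡fʲx = trans (^-suc f k x) (trans (cong f fᵏx≡fˡx)
                (trans (sym (^-suc f l x)) (cong (λ m → (f ^ m) x) (≤-antisym l<j (≮⇒≥ 1+l≮j)))))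

T-allᵇ-iterate⁺ : ∀ P f k {x} → (∀ {i} → i < k → T (P ((f ^ i) x))) → T (allᵇ P (iterate f x k))
T-allᵇ-iterate⁺ P f zero    _   = tt
T-allᵇ-iterate⁺ P f (suc k) Pfⁱ = from T-∧ (Pfⁱ z<s , T-allᵇ-iterate⁺ P f k (Pfⁱ ∘ s<s))

T-allᵇ-iterate⁻ : ∀ P f k {x} → T (allᵇ P (iterate f x k)) → ∀ {i} → i < k → T (P ((f ^ i) x))
T-allᵇ-iterate⁻ P f (suc k) all {zero}  _         = proj₁ (to T-∧ all)
T-allᵇ-iterate⁻ P f (suc k) all {suc i} (s<s i<k) = T-allᵇ-iterate⁻ P f k (proj₂ (to T-∧ all)) i<k

IsOrbitMin : (ℕ → ℕ) → ℕ → Set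
IsOrbitMin f x = ∀ k → x ≤ (f ^ k) x

isCycleMin-fixed : ∀ n {f x} → f x ≡ x → T (isCycleMin n f x)
isCycleMin-fixed n {f} fx≡x =
  T-allᵇ-iterate⁺ _ f (suc n) (λ {k} _ → ≤⇒≤ᵇ (≤-reflexive (sym (^-fixed fx≡x k))))

module _ {n} {f : ℕ → ℕ} (f-into : ∀ {x} → x ∈ ⟦ 1 , n ⟧ → f x ∈ ⟦ 1 , n ⟧) where

  ^-into : ∀ k {x} → x ∈ ⟦ 1 , n ⟧ → (f ^ k) x ∈ ⟦ 1 , n ⟧
  ^-into zero    x∈ = x∈
  ^-into (suc k) x∈ = ^-into k (f-into x∈)

  ^-recurrent : ∀ {x} → x ∈ ⟦ 1 , n ⟧ → ∀ k → ∃ λ l → l ≤ n × (f ^ k) x ≡ (f ^ l) x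
  ^-recurrent {x} x∈ k =
    let i , j , i<j , same-position = pigeonhole (n<1+n (suc n)) position
        l , l<j , fᵏx≡fˡx = ^-mod-period i<j (position-injective {i} {j} same-position) k
    in l , s≤s⁻¹ (≤-trans l<j (s≤s⁻¹ (toℕ<n j))) , fᵏx≡fˡx
    where
    -- the first n + 2 iterates all lie in ⟦1, n⟧, so two of them coincide
    position : Fin (suc (suc n)) → Fin (suc n)
    position i = fromℕ< (s≤s (proj₂ (^-into (toℕ i) x∈)))
    position-injective : ∀ {i j} → position i ≡ position j → (f ^ toℕ i) x ≡ (f ^ toℕ j) x
    position-injective eq = trans (sym (toℕ-fromℕ< _)) (trans (cong toℕ eq) (toℕ-fromℕ< _))

  isCycleMin⇔IsOrbitMin : ∀ {x} → x ∈ ⟦ 1 , n ⟧ → T (isCycleMin n f x) ⇔ IsOrbitMin f x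
  isCycleMin⇔IsOrbitMin {x} x∈ = mk⇔ orbitMin cycleMin
    where
    orbitMin : T (isCycleMin n f x) → IsOrbitMin f x
    orbitMin min k with ^-recurrent x∈ k
    ... | l , l≤n , fᵏx≡fˡx =
      subst (x ≤_) (sym fᵏx≡fˡx) (≤ᵇ⇒≤ x _ (T-allᵇ-iterate⁻ _ f (suc n) min (s≤s l≤n)))
    cycleMin : IsOrbitMin f x → T (isCycleMin n f x)
    cycleMin min = T-allᵇ-iterate⁺ _ f (suc n) (λ {k} _ → ≤⇒≤ᵇ (min k))

module _ {f g ι : ℕ → ℕ} {D : Pred ℕ 0ℓ}
         (g-into : ∀ {y} → y ∈ D → g y ∈ D)
         (intertwine : ∀ {y} → y ∈ D → f (ι y) ≡ ι (g y))
         (ι-strict : ι Preserves _<_ ⟶ _<_) where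

  ^-intertwine : ∀ k {y} → y ∈ D → (f ^ k) (ι y) ≡ ι ((g ^ k) y)
  ^-intertwine zero    _  = refl
  ^-intertwine (suc k) y∈ = trans (cong (f ^ k) (intertwine y∈)) (^-intertwine k (g-into y∈))

  IsOrbitMin-intertwine : ∀ {y} → y ∈ D → IsOrbitMin f (ι y) ⇔ IsOrbitMin g y
  IsOrbitMin-intertwine {y} y∈ = mk⇔
    (λ min k → ι-reflect (subst (ι y ≤_) (^-intertwine k y∈) (min k)))
    (λ min k → subst (ι y ≤_) (sym (^-intertwine k y∈)) (ι-mono (min k)))
    where
    ι-mono : ∀ {u v} → u ≤ v → ι u ≤ ι v
    ι-mono u≤v with m≤n⇒m<n∨m≡n u≤v
    ... | inj₁ u<v  = <⇒≤ (ι-strict u<v)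
    ... | inj₂ refl = ≤-refl
    ι-reflect : ∀ {u v} → ι u ≤ ι v → u ≤ v
    ι-reflect ιu≤ιv = ≮⇒≥ (λ v<u → <⇒≱ (ι-strict v<u) ιu≤ιv)

countᵇ : (ℕ → Bool) → List ℕ → ℕ
countᵇ P xs = length (filterᵇ P xs)

γ≡countᵇ : ∀ n f → γ n f ≡ countᵇ (isCycleMin n f) (applyUpTo suc n)
γ≡countᵇ n f = cong (countᵇ (isCycleMin n f)) (map-upTo suc n)

applyUpTo-+ : ∀ (f : ℕ → ℕ) m n → applyUpTo f (m + n) ≡ applyUpTo f m ++ applyUpTo (f ∘ (m +_)) n
applyUpTo-+ f zero    n = refl
applyUpTo-+ f (suc m) n = cong (f 0 ∷_) (applyUpTo-+ (f ∘ suc) m n)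

countᵇ-++ : ∀ P xs ys → countᵇ P (xs ++ ys) ≡ countᵇ P xs + countᵇ P ys
countᵇ-++ P xs ys = trans (cong length (filter-++ (T? ∘ P) xs ys)) (length-++ (filterᵇ P xs))

countᵇ-applyUpTo-+ : ∀ P f m n →
  countᵇ P (applyUpTo f (m + n)) ≡ countᵇ P (applyUpTo f m) + countᵇ P (applyUpTo (f ∘ (m +_)) n)
countᵇ-applyUpTo-+ P f m n = trans (cong (countᵇ P) (applyUpTo-+ f m n)) (countᵇ-++ P (applyUpTo f m) _)

countᵇ-applyUpTo-cong : ∀ k {P Q : ℕ → Bool} {f g : ℕ → ℕ} →
                        (∀ {i} → i < k → T (P (f i)) ⇔ T (Q (g i))) →
                        countᵇ P (applyUpTo f k) ≡ countᵇ Q (applyUpTo g k)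
countᵇ-applyUpTo-cong zero    _ = refl
countᵇ-applyUpTo-cong (suc k) {P} {Q} {f} {g} P⇔Q with P (f 0) | Q (g 0) | P⇔Q {0} z<s
... | true  | true  | _ = cong suc (countᵇ-applyUpTo-cong k (P⇔Q ∘ s<s))
... | false | false | _ = countᵇ-applyUpTo-cong k (P⇔Q ∘ s<s)
... | true  | false | P⇔Q₀ = ⊥-elim (to P⇔Q₀ tt)
... | false | true  | P⇔Q₀ = ⊥-elim (from P⇔Q₀ tt)

countᵇ-applyUpTo-all : ∀ k {P : ℕ → Bool} {f : ℕ → ℕ} →
                       (∀ {i} → i < k → T (P (f i))) → countᵇ P (applyUpTo f k) ≡ k
countᵇ-applyUpTo-all zero    _   = refl
countᵇ-applyUpTo-all (suc k) {P} {f} Pf with P (f 0) | Pf {0} z<s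
... | true | _ = cong suc (countᵇ-applyUpTo-all k (Pf ∘ s<s))

module Splice (L : List ℕ) (p : ℕ) (R : List ℕ) (balanced : sum R ≡ sum L) where

  a : ℕ
  a = sum L

  LpR LR : List ℕ
  LpR = L ++ p ∷ R
  LR  = L ++ R

  sum-LpR : sum LpR ≡ a + (p + a)
  sum-LpR = trans (sum-++ L (p ∷ R)) (cong (λ s → a + (p + s)) balanced)

  sum-LR : sum LR ≡ a + a
  sum-LR = trans (sum-++ L R) (cong (a +_) balanced)

  T-low : ∀ {y} → y ∈ ⟦ 1 , a ⟧ → Tλ LpR y ≡ Tλ LR y + p
  T-low {y} y∈ = begin
    Tλ LpR y                   ≡⟨ T-go-++ˡ 0 L (p ∷ R) y∈ ⟩
    Tλ L y + (p + sum R)       ≡⟨ x∙yz≈y∙xz (Tλ L y) p (sum R) ⟩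
    p + (Tλ L y + sum R)       ≡⟨ +-comm p _ ⟩
    Tλ L y + sum R + p         ≡⟨ cong (_+ p) (T-go-++ˡ 0 L R y∈) ⟨
    Tλ LR y + p                ∎
    where open ≡-Reasoning

  T-low-above : ∀ {y} → y ∈ ⟦ 1 , a ⟧ → a < Tλ LR y
  T-low-above y∈ = subst (a <_) (sym (T-go-++ˡ 0 L R y∈))
    (subst (λ s → s < Tλ L _ + sum R) balanced (+-monoˡ-≤ (sum R) (proj₁ (T-go-range 0 L y∈))))

  T-high : ∀ {y} → y ∈ ⟦ suc a , a + a ⟧ → Tλ LpR (y + p) ≡ Tλ LR y
  T-high {y} (a<y , y≤a+a) = begin
    Tλ LpR (y + p)             ≡⟨ T-go-++ʳ 0 L (p ∷ R) (<-≤-trans a<y (m≤m+n y p)) ⟩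
    T-go a (p ∷ R) (y + p)     ≡⟨ T-go-tail a p R (+-monoˡ-< p a<y) ⟩
    T-go (a + p) R (y + p)     ≡⟨ T-go-shift a p R (a<y , subst (λ s → y ≤ a + s) (sym balanced) y≤a+a) ⟩
    T-go a R y                 ≡⟨ T-go-++ʳ 0 L R a<y ⟨
    Tλ LR y                    ∎
    where open ≡-Reasoning

  T-high-below : ∀ {y} → y ∈ ⟦ suc a , a + a ⟧ → Tλ LR y ≤ a
  T-high-below {y} (a<y , y≤a+a) = subst (_≤ a) (sym (T-go-++ʳ 0 L R a<y))
    (subst (T-go a R y ≤_) balanced
      (proj₂ (T-go-range a R (a<y , subst (λ s → y ≤ a + s) (sym balanced) y≤a+a))))

  T-mid : ∀ {x} → x ∈ ⟦ suc a , a + p ⟧ → Tλ LpR x ≡ x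
  T-mid {x} (a<x , x≤a+p) = begin
    Tλ LpR x                   ≡⟨ T-go-++ʳ 0 L (p ∷ R) a<x ⟩
    T-go a (p ∷ R) x           ≡⟨ T-go-head a p R x≤a+p ⟩
    x + sum R ∸ a              ≡⟨ cong (λ s → x + s ∸ a) balanced ⟩
    x + a ∸ a                  ≡⟨ m+n∸n≡m x a ⟩
    x                          ∎
    where open ≡-Reasoning

  ι : ℕ → ℕ
  ι y = if y ≤ᵇ a then y else y + p

  ι-low : ∀ {y} → y ≤ a → ι y ≡ y
  ι-low {y} y≤a rewrite dec-true (y ≤? a) y≤a = refl

  ι-high : ∀ {y} → a < y → ι y ≡ y + p
  ι-high {y} a<y rewrite dec-false (y ≤? a) (<⇒≱ a<y) = refl

  ι-strict : ι Preserves _<_ ⟶ _<_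
  ι-strict {y} {z} y<z with y ≤? a | z ≤? a
  ... | yes y≤a | yes z≤a rewrite ι-low y≤a | ι-low z≤a = y<z
  ... | yes y≤a | no  z≰a rewrite ι-low y≤a | ι-high (≰⇒> z≰a) = ≤-trans y<z (m≤m+n z p)
  ... | no  y≰a | yes z≤a = contradiction (<-trans (≰⇒> y≰a) y<z) (≤⇒≯ z≤a)
  ... | no  y≰a | no  z≰a rewrite ι-high (≰⇒> y≰a) | ι-high (≰⇒> z≰a) = +-monoˡ-< p y<z

  ι-into : ∀ {y} → y ∈ ⟦ 1 , sum LR ⟧ → ι y ∈ ⟦ 1 , sum LpR ⟧
  ι-into {y} (1≤y , y≤LR) rewrite sum-LpR with y ≤? a
  ... | yes y≤a rewrite ι-low y≤a = 1≤y , ≤-trans y≤a (m≤m+n a (p + a))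
  ... | no  y≰a rewrite ι-high (≰⇒> y≰a) = ≤-trans 1≤y (m≤m+n y p) , (begin
    y + p                      ≤⟨ +-monoˡ-≤ p (≤-trans y≤LR (≤-reflexive sum-LR)) ⟩
    a + a + p                  ≡⟨ xy∙z≈xz∙y a a p ⟩
    a + p + a                  ≡⟨ +-assoc a p a ⟩
    a + (p + a)                ∎)
    where open ≤-Reasoning

  T-intertwine : ∀ {y} → y ∈ ⟦ 1 , sum LR ⟧ → Tλ LpR (ι y) ≡ ι (Tλ LR y)
  T-intertwine {y} (1≤y , y≤LR) with y ≤? a
  ... | yes y≤a rewrite ι-low y≤a | ι-high (T-low-above (1≤y , y≤a)) = T-low (1≤y , y≤a)
  ... | no  y≰a = high (≰⇒> y≰a , ≤-trans y≤LR (≤-reflexive sum-LR))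
    where
    high : y ∈ ⟦ suc a , a + a ⟧ → Tλ LpR (ι y) ≡ ι (Tλ LR y)
    high y∈ rewrite ι-high (proj₁ y∈) | ι-low (T-high-below y∈) = T-high y∈

  P⁺ P⁻ : ℕ → Bool
  P⁺ = isCycleMin (sum LpR) (Tλ LpR)
  P⁻ = isCycleMin (sum LR) (Tλ LR)

  isCycleMin-ι : ∀ {y} → y ∈ ⟦ 1 , sum LR ⟧ → T (P⁺ (ι y)) ⇔ T (P⁻ y)
  isCycleMin-ι y∈ =
    ⇔-trans (isCycleMin⇔IsOrbitMin (Tλ-into LpR) (ι-into y∈))
    (⇔-trans (IsOrbitMin-intertwine (Tλ-into LR) T-intertwine ι-strict y∈)
             (⇔-sym (isCycleMin⇔IsOrbitMin (Tλ-into LR) y∈)))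

  a≤LR : a ≤ sum LR
  a≤LR = ≤-trans (m≤m+n a a) (≤-reflexive (sym sum-LR))

  isCycleMin-low : ∀ {i} → i < a → T (P⁺ (suc i)) ⇔ T (P⁻ (suc i))
  isCycleMin-low {i} i<a =
    subst (λ x → T (P⁺ x) ⇔ T (P⁻ (suc i))) (ι-low i<a) (isCycleMin-ι (s≤s z≤n , ≤-trans i<a a≤LR))

  isCycleMin-mid : ∀ {i} → i < p → T (P⁺ (suc (a + i)))
  isCycleMin-mid {i} i<p = isCycleMin-fixed (sum LpR)
    (T-mid (s≤s (m≤m+n a i) , subst (_≤ a + p) (+-suc a i) (+-monoʳ-≤ a i<p)))

  isCycleMin-high : ∀ {i} → i < a → T (P⁺ (suc (a + (p + i)))) ⇔ T (P⁻ (suc (a + i)))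
  isCycleMin-high {i} i<a =
    subst (λ x → T (P⁺ x) ⇔ T (P⁻ (suc (a + i)))) ι[1+a+i]≡1+a+[p+i] (isCycleMin-ι (s≤s z≤n , 1+a+i≤LR))
    where
    ι[1+a+i]≡1+a+[p+i] : ι (suc (a + i)) ≡ suc (a + (p + i))
    ι[1+a+i]≡1+a+[p+i] = trans (ι-high (s≤s (m≤m+n a i))) (cong suc (xy∙z≈x∙zy a i p))
    1+a+i≤LR : suc (a + i) ≤ sum LR
    1+a+i≤LR = ≤-trans (subst (_≤ a + a) (+-suc a i) (+-monoʳ-≤ a i<a)) (≤-reflexive (sym sum-LR))

  γT-splice : γT LpR ≡ p + γT LR
  γT-splice = begin
    γT LpR                                        ≡⟨ γ≡countᵇ (sum LpR) (Tλ LpR) ⟩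
    countᵇ P⁺ (applyUpTo suc (sum LpR))           ≡⟨ cong (countᵇ P⁺ ∘ applyUpTo suc) sum-LpR ⟩
    countᵇ P⁺ (applyUpTo suc (a + (p + a)))       ≡⟨ countᵇ-applyUpTo-+ P⁺ suc a (p + a) ⟩
    low⁺ + countᵇ P⁺ (applyUpTo mid+high (p + a)) ≡⟨ cong (low⁺ +_) (countᵇ-applyUpTo-+ P⁺ mid+high p a) ⟩
    low⁺ + (mid⁺ + high⁺)                         ≡⟨ cong₂ _+_ low (cong₂ _+_ mid high) ⟩
    low⁻ + (p + high⁻)                            ≡⟨ x∙yz≈y∙xz low⁻ p high⁻ ⟩
    p + (low⁻ + high⁻)                            ≡⟨ cong (p +_) (countᵇ-applyUpTo-+ P⁻ suc a a) ⟨
    p + countᵇ P⁻ (applyUpTo suc (a + a))         ≡⟨ cong (λ n → p + countᵇ P⁻ (applyUpTo suc n)) sum-LR ⟨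
    p + countᵇ P⁻ (applyUpTo suc (sum LR))        ≡⟨ cong (p +_) (γ≡countᵇ (sum LR) (Tλ LR)) ⟨
    p + γT LR                                     ∎
    where
    open ≡-Reasoning
    mid+high : ℕ → ℕ
    mid+high i = suc (a + i)
    low⁺ mid⁺ high⁺ low⁻ high⁻ : ℕ
    low⁺  = countᵇ P⁺ (applyUpTo suc a)
    mid⁺  = countᵇ P⁺ (applyUpTo mid+high p)
    high⁺ = countᵇ P⁺ (applyUpTo (mid+high ∘ (p +_)) a)
    low⁻  = countᵇ P⁻ (applyUpTo suc a)
    high⁻ = countᵇ P⁻ (applyUpTo mid+high a)
    low : low⁺ ≡ low⁻
    low = countᵇ-applyUpTo-cong a isCycleMin-low
    mid : mid⁺ ≡ p
    mid = countᵇ-applyUpTo-all p isCycleMin-mid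
    high : high⁺ ≡ high⁻
    high = countᵇ-applyUpTo-cong a isCycleMin-high

take++lookup∷drop : ∀ {A : Set} (xs : List A) (t : Fin (length xs)) →
                    take (toℕ t) xs ++ lookup xs t ∷ drop (suc (toℕ t)) xs ≡ xs
take++lookup∷drop (x ∷ xs) zero    = refl
take++lookup∷drop (x ∷ xs) (suc t) = cong (x ∷_) (take++lookup∷drop xs t)

removeAt≡take++drop : ∀ {A : Set} (xs : List A) (t : Fin (length xs)) →
                      removeAt xs t ≡ take (toℕ t) xs ++ drop (suc (toℕ t)) xs
removeAt≡take++drop (x ∷ xs) zero    = refl
removeAt≡take++drop (x ∷ xs) (suc t) = cong (x ∷_) (removeAt≡take++drop xs t)

lemma3 : (λs : List ℕ) → All (λ p → 0 < p) λs → (t : Fin (length λs))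
         → sum (drop (suc (toℕ t)) λs) ≡ sum (take (toℕ t) λs)
         → γT λs ≡ lookup λs t + γT (removeAt λs t)
lemma3 λs _ t balanced = begin
  γT λs                                      ≡⟨ cong γT (take++lookup∷drop λs t) ⟨
  γT (take t′ λs ++ λₜ ∷ drop (suc t′) λs)   ≡⟨ Splice.γT-splice (take t′ λs) λₜ _ balanced ⟩
  λₜ + γT (take t′ λs ++ drop (suc t′) λs)   ≡⟨ cong (λ μ → λₜ + γT μ) (removeAt≡take++drop λs t) ⟨
  λₜ + γT (removeAt λs t)                    ∎
  where
  open ≡-Reasoning
  t′ λₜ : ℕ
  t′ = toℕ t
  λₜ = lookup λs t
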